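{- Let $l \geq 2$ and let $n$ be an even positive integer with $n \leq 2^l$. Then the de Bruijn graph $G_l$ contains a balanced circuit of length $n$.
   Context: For $l \geq 2$, the de Bruijn graph $G_l$ is the directed graph (loops allowed) with vertex set $\{0,1\}^{l-1}$ and edge set $\{0,1\}^l$, where the edge $b_0b_1\cdots b_{l-1}$ goes from the vertex $b_0b_1\cdots b_{l-2}$ to the vertex $b_1b_2\cdots b_{l-1}$. An edge is red if its last bit is $0$ and blue if its last bit is $1$; a circuit is balanced if it contains equally many red and blue edges. A circuit of length $n$ is a closed directed walk of $n$ edges, with no edge repeated, beginning and ending at the same vertex. -}

module Defs where

open import Data.Bool using (Bool; true; false)
open import Data.Nat using (ℕ; suc; _+_)
open import Data.Vec using (Vec; init; tail; last)
open import Data.List using (List; []; _∷_; length; filter)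
open import Data.List.Relation.Unary.Unique.Propositional using (Unique)
open import Relation.Binary.PropositionalEquality using (_≡_)
open import Data.Product using (_×_)
open import Data.Unit using (⊤)
open import Data.Empty using (⊥)
open import Relation.Nullary.Decidable using (Dec; yes; no)
open import Data.Bool using (_≟_)

-- The de Bruijn graph G_l with l = suc m:
-- vertices are bit strings of length m = l - 1, edges are bit strings of length l.
Vertex : ℕ → Set
Vertex m = Vec Bool m

Edge : ℕ → Set
Edge m = Vec Bool (suc m)

source : {m : ℕ} → Edge m → Vertex m
source e = init e

target : {m : ℕ} → Edge m → Vertex m
target e = tail e

IsRed : {m : ℕ} → Edge m → Set
IsRed e = last e ≡ false

IsBlue : {m : ℕ} → Edge m → Set
IsBlue e = last e ≡ true

ChainTo : {m : ℕ} → List (Edge m) → Vertex m → Set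
ChainTo [] v = ⊤
ChainTo (e ∷ []) v = target e ≡ v
ChainTo (e ∷ f ∷ es) v = (target e ≡ source f) × ChainTo (f ∷ es) v

IsCircuit : {m : ℕ} → List (Edge m) → Set
IsCircuit [] = ⊥
IsCircuit (e ∷ es) = ChainTo (e ∷ es) (source e) × Unique (e ∷ es)

redCount : {m : ℕ} → List (Edge m) → ℕ
redCount es = length (filter (λ e → last e ≟ false) es)

blueCount : {m : ℕ} → List (Edge m) → ℕ
blueCount es = length (filter (λ e → last e ≟ true) es)

IsBalanced : {m : ℕ} → List (Edge m) → Set
IsBalanced es = redCount es ≡ blueCount es

-- Lempel's D-morphism, which replaces consecutive bits by their sum mod 2, maps G_{l+1} onto G_l
-- two-to-one, and the two preimages of an edge are complementary bit strings, hence of opposite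
-- colours. If a circuit of G_l has odd parity (an odd number of its edges start with 1), its lift
-- is a single circuit of twice the length using both preimages of each edge, so it is balanced.
-- A circuit through the loop 1…1 can be lifted the same way after removing that loop, the two
-- preimages of the loop forming a 2-cycle that is spliced back in. It therefore suffices to find,
-- in every G_l, circuits of each length k ≤ 2^l which are odd or pass through 1…1.
--
-- These are produced by induction on l together with rich circuits: circuits through the loop
-- 0…0 that start with a closed walk of length 3 and even parity and are odd or pass through 1…1.
-- Lifting a rich circuit of length j gives a circuit of length 2j through both 0…0 and 1…1 which
-- contains the two lifts of the 3-walk, of opposite parities. Deleting some of the loops and the
-- odd 3-walk yields rich circuits of lengths 2j, 2j − 1, 2j − 3 and odd circuits of lengths 2j − 1
-- and, depending on the parity of j, 2j or 2j − 4; these cover the next range of lengths. The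
-- induction starts at l = 5, and smaller orders are checked by computation.

module Submission where

open import Defs

import Algebra.Solver.CommutativeMonoid as CommutativeMonoidSolver
import Algebra.Solver.Monoid as MonoidSolver
open import Data.Bool as Bool using (Bool; true; false; not; _xor_; _≟_)
open import Data.Bool.Properties
  using (not-involutive; not-¬; ¬-not; xor-assoc; xor-comm; xor-identityʳ; xor-inverseʳ;
         not-distribˡ-xor; not-distribʳ-xor)
open import Data.Empty using (⊥; ⊥-elim)
open import Data.List as List using (List; []; _∷_; _++_; length; filter)
import Data.List.Membership.DecPropositional as MembershipDec
open import Data.List.Membership.Propositional using (_∈_; _∉_)
open import Data.List.Membership.Propositional.Properties using (∈-++⁺ˡ; ∈-++⁺ʳ; ∈-++⁻; ∈-∃++)
open import Data.List.Properties using (++-assoc; ++-monoid; take++drop≡id; length-++; filter-accept; filter-reject)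
open import Data.List.Relation.Binary.Permutation.Propositional
  using (_↭_; refl; prep; swap; trans; ↭-refl; ↭-sym; ↭-trans; ↭-reflexive; ↭⇒↭ₛ; module PermutationReasoning)
open import Data.List.Relation.Binary.Permutation.Propositional.Properties
  using (↭-length; ∈-resp-↭; filter-↭; shift; shifts; ++-comm; ++⁺ˡ; ++-commutativeMonoid)
import Data.List.Relation.Binary.Permutation.Setoid.Properties as PermSetoid
open import Data.List.Relation.Unary.All using (All; _∷_)
open import Data.List.Relation.Unary.All.Properties using (¬Any⇒All¬; All¬⇒¬Any)
open import Data.List.Relation.Unary.AllPairs using ([]; _∷_)
open import Data.List.Relation.Unary.Any using (here; there)
import Data.List.Relation.Unary.Unique.DecPropositional as UniqueDec
open import Data.List.Relation.Unary.Unique.Propositional using (Unique)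
open import Data.List.Relation.Unary.Unique.Propositional.Properties using (map⁻)
open import Data.Nat as ℕ using (ℕ; zero; suc; s≤s; _+_; _*_; _∸_; _^_; _≤_; _<_; _≤?_; _<?_)
open import Data.Nat.Properties
  using (+-suc; +-identityʳ; +-cancelˡ-≡; suc-injective; +-mono-≤; +-mono-<; ≤-trans; ≤-antisym; ≤-pred;
         <-trans; <⇒≤; <⇒≱; ≰⇒>; ≮⇒≥; ≤∧≢⇒<; m≤n⇒m≤1+n; n≤1+n; n<1+n; m≤m+n; m+[n∸m]≡n; *-cancelˡ-≤;
         allUpTo?)
open import Data.Product using (Σ; _×_; _,_; proj₁; proj₂; ∃)
open import Data.String as String using (String)
open import Data.Sum as Sum using (_⊎_; inj₁; inj₂)
open import Data.Vec as Vec using (Vec; []; _∷_; head; tail; init; last; replicate)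
open import Data.Vec.Properties using (≡-dec)
open import Function using (_∘_)
open import Relation.Binary.PropositionalEquality as ≡
  using (_≡_; _≢_; refl; sym; cong; cong₂; subst; subst₂; module ≡-Reasoning)
open import Relation.Nullary using (Dec; yes; no)
open import Relation.Nullary.Decidable using (_×-dec_; _⊎-dec_; _→-dec_; from-yes)

private variable n : ℕ

xor-cancelˡ : ∀ a b → a xor (a xor b) ≡ b
xor-cancelˡ true b = not-involutive b
xor-cancelˡ false b = refl

odd : ℕ → Bool
odd zero = false
odd (suc k) = not (odd k)

odd-+-self : ∀ k → odd (k + k) ≡ false
odd-+-self zero = refl
odd-+-self (suc k) = ≡.trans (cong (λ m → not (odd m)) (+-suc k k)) (≡.trans (not-involutive _) (odd-+-self k))

suc-+-suc : ∀ i → suc i + suc i ≡ suc (suc (i + i))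
suc-+-suc i = cong suc (+-suc i i)

halve : ∀ k → ∃ λ i → k ≡ i + i ⊎ k ≡ suc (i + i)
halve zero = 0 , inj₁ refl
halve (suc k) with halve k
... | i , inj₁ e = i , inj₂ (cong suc e)
... | i , inj₂ e = suc i , inj₁ (≡.trans (cong suc e) (sym (suc-+-suc i)))

double-≤-inv : ∀ a b → a + a ≤ b + b → a ≤ b
double-≤-inv a b p with a ≤? b
... | yes a≤b = a≤b
... | no a≰b = ⊥-elim (<⇒≱ (+-mono-< (≰⇒> a≰b) (≰⇒> a≰b)) p)

double-<-inv : ∀ a b → a + a < b + b → a < b
double-<-inv a b p with b ≤? a
... | yes b≤a = ⊥-elim (<⇒≱ p (+-mono-≤ b≤a b≤a))
... | no b≰a = ≰⇒> b≰a

2^suc : ∀ n → 2 ^ suc n ≡ 2 ^ n + 2 ^ n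
2^suc n = cong (2 ^ n +_) (+-identityʳ (2 ^ n))

unique-↭ : {A : Set} {xs ys : List A} → xs ↭ ys → Unique xs → Unique ys
unique-↭ {A} p = PermSetoid.Unique-resp-↭ (≡.setoid A) (↭⇒↭ₛ p)

unique-++ʳ : {A : Set} (xs : List A) {ys : List A} → Unique (xs ++ ys) → Unique ys
unique-++ʳ [] u = u
unique-++ʳ (x ∷ xs) (_ ∷ u) = unique-++ʳ xs u

unique-++-disjoint : {A : Set} (xs : List A) {ys : List A} {x : A} → Unique (xs ++ ys) → x ∈ ys → x ∉ xs
unique-++-disjoint (z ∷ xs) (z∉ ∷ u) x∈ys (here refl) = All¬⇒¬Any z∉ (∈-++⁺ʳ xs x∈ys)
unique-++-disjoint (z ∷ xs) (_ ∷ u) x∈ys (there p) = unique-++-disjoint xs u x∈ys p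

∈-between : {A : Set} (K R K′ R′ : List A) {x : A} → x ∈ K ++ R ++ K′ ++ R′ → x ∉ K → x ∉ K′ → x ∈ R ++ R′
∈-between K R K′ R′ m ∉K ∉K′ with ∈-++⁻ K m
... | inj₁ p = ⊥-elim (∉K p)
... | inj₂ m′ with ∈-++⁻ R m′
...   | inj₁ p = ∈-++⁺ˡ p
...   | inj₂ m″ with ∈-++⁻ K′ m″
...     | inj₁ p = ⊥-elim (∉K′ p)
...     | inj₂ p = ∈-++⁺ʳ R p

∈-++-middle : {A : Set} (xs ys zs : List A) {x : A} → x ∈ xs ++ zs → x ∈ xs ++ ys ++ zs
∈-++-middle xs ys zs m with ∈-++⁻ xs m
... | inj₁ p = ∈-++⁺ˡ p
... | inj₂ p = ∈-++⁺ʳ xs (∈-++⁺ʳ ys p)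

∈-after-removal : {A : Set} {r r′ : List A} {x y : A} → r ↭ x ∷ r′ → y ∈ r → y ≢ x → y ∈ r′
∈-after-removal removed y∈r y≢x with ∈-resp-↭ removed y∈r
... | here y≡x = ⊥-elim (y≢x y≡x)
... | there p = p

complement : Vec Bool n → Vec Bool n
complement = Vec.map not

diff : Vec Bool (suc n) → Vec Bool n
diff (x ∷ []) = []
diff (x ∷ y ∷ ys) = (x xor y) ∷ diff (y ∷ ys)

integrate : Bool → Vec Bool n → Vec Bool (suc n)
integrate b [] = b ∷ []
integrate b (x ∷ xs) = b ∷ integrate (b xor x) xs

head-integrate : ∀ b (e : Vec Bool n) → head (integrate b e) ≡ b
head-integrate b [] = refl
head-integrate b (x ∷ e) = refl

diff-integrate : ∀ b (e : Vec Bool n) → diff (integrate b e) ≡ e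
diff-integrate b [] = refl
diff-integrate b (x ∷ []) = cong (_∷ []) (xor-cancelˡ b x)
diff-integrate b (x ∷ y ∷ e) = cong₂ _∷_ (xor-cancelˡ b x) (diff-integrate (b xor x) (y ∷ e))

init-integrate : ∀ b (e : Vec Bool (suc n)) → init (integrate b e) ≡ integrate b (init e)
init-integrate b (x ∷ []) = refl
init-integrate b (x ∷ y ∷ e) = cong (b ∷_) (init-integrate (b xor x) (y ∷ e))

tail-integrate : ∀ b (e : Vec Bool (suc n)) → tail (integrate b e) ≡ integrate (b xor head e) (tail e)
tail-integrate b (x ∷ e) = refl

integrate-not : ∀ b (e : Vec Bool n) → integrate (not b) e ≡ complement (integrate b e)
integrate-not b [] = refl
integrate-not b (x ∷ e) =
  cong (not b ∷_) (≡.trans (cong (λ c → integrate c e) (sym (not-distribˡ-xor b x))) (integrate-not (b xor x) e))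

last-complement : (e : Vec Bool (suc n)) → last (complement e) ≡ not (last e)
last-complement (x ∷ []) = refl
last-complement (x ∷ y ∷ e) = last-complement (y ∷ e)

integrate-replicate : ∀ n b → integrate b (replicate n false) ≡ replicate (suc n) b
integrate-replicate zero b = refl
integrate-replicate (suc n) b =
  cong (b ∷_) (≡.trans (cong (λ c → integrate c (replicate n false)) (xor-identityʳ b)) (integrate-replicate n b))

init-replicate : ∀ n (b : Bool) → init (replicate (suc n) b) ≡ replicate n b
init-replicate zero b = refl
init-replicate (suc n) b = cong (b ∷_) (init-replicate n b)

parity : List (Edge n) → Bool
parity [] = false
parity (e ∷ es) = head e xor parity es

parity-++ : (xs ys : List (Edge n)) → parity (xs ++ ys) ≡ parity xs xor parity ys
parity-++ [] ys = refl
parity-++ (x ∷ xs) ys = ≡.trans (cong (head x xor_) (parity-++ xs ys)) (sym (xor-assoc (head x) (parity xs) (parity ys)))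

parity-↭ : {xs ys : List (Edge n)} → xs ↭ ys → parity xs ≡ parity ys
parity-↭ refl = refl
parity-↭ (prep x p) = cong (head x xor_) (parity-↭ p)
parity-↭ {xs = x ∷ y ∷ xs} {y ∷ x ∷ ys} (swap x y p) = begin
  head x xor (head y xor parity xs)  ≡⟨ sym (xor-assoc (head x) (head y) _) ⟩
  (head x xor head y) xor parity xs  ≡⟨ cong₂ _xor_ (xor-comm (head x) (head y)) (parity-↭ p) ⟩
  (head y xor head x) xor parity ys  ≡⟨ xor-assoc (head y) (head x) _ ⟩
  head y xor (head x xor parity ys)  ∎
  where open ≡-Reasoning
parity-↭ (trans p q) = ≡.trans (parity-↭ p) (parity-↭ q)

redCount-↭ : {xs ys : List (Edge n)} → xs ↭ ys → redCount xs ≡ redCount ys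
redCount-↭ p = ↭-length (filter-↭ _ p)

blueCount-↭ : {xs ys : List (Edge n)} → xs ↭ ys → blueCount xs ≡ blueCount ys
blueCount-↭ p = ↭-length (filter-↭ _ p)

countOf : Bool → List (Edge n) → ℕ
countOf b es = length (filter (λ e → last e ≟ b) es)

count-hit : ∀ b (x : Edge n) zs → last x ≡ b → countOf b (x ∷ zs) ≡ suc (countOf b zs)
count-hit b x zs p = cong length (filter-accept {P = λ e → last e ≡ b} (λ e → last e ≟ b) {x} {zs} p)

count-miss : ∀ b (x : Edge n) zs → last x ≡ not b → countOf b (x ∷ zs) ≡ countOf b zs
count-miss b x zs p = cong length (filter-reject {P = λ e → last e ≡ b} (λ e → last e ≟ b) {x} {zs} (λ q → not-¬ q p))

count-opposite : ∀ b (x y : Edge n) zs → last y ≡ not (last x) → countOf b (x ∷ y ∷ zs) ≡ suc (countOf b zs)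
count-opposite b x y zs ly = by-colour-of-x (last x ≟ b)
  where
  by-colour-of-x : Dec (last x ≡ b) → countOf b (x ∷ y ∷ zs) ≡ suc (countOf b zs)
  by-colour-of-x (yes p) = ≡.trans (count-hit b x _ p) (cong suc (count-miss b y zs (≡.trans ly (cong not p))))
  by-colour-of-x (no ¬p) =
    ≡.trans (count-miss b x _ q) (count-hit b y zs (≡.trans ly (≡.trans (cong not q) (not-involutive b))))
    where q = ¬-not ¬p

preimage : List (Edge n) → List (Edge (suc n))
preimage [] = []
preimage (e ∷ es) = integrate false e ∷ integrate true e ∷ preimage es

preimage-↭ : {xs ys : List (Edge n)} → xs ↭ ys → preimage xs ↭ preimage ys
preimage-↭ refl = refl
preimage-↭ (prep x p) = prep _ (prep _ (preimage-↭ p))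
preimage-↭ (swap x y p) =
  ↭-trans (shifts (integrate false x ∷ integrate true x ∷ []) (integrate false y ∷ integrate true y ∷ []))
    (prep _ (prep _ (prep _ (prep _ (preimage-↭ p)))))
preimage-↭ (trans p q) = trans (preimage-↭ p) (preimage-↭ q)

length-preimage : (es : List (Edge n)) → length (preimage es) ≡ length es + length es
length-preimage [] = refl
length-preimage (e ∷ es) = cong suc (≡.trans (cong suc (length-preimage es)) (sym (+-suc (length es) (length es))))

parity-preimage : (es : List (Edge n)) → parity (preimage es) ≡ odd (length es)
parity-preimage [] = refl
parity-preimage (e ∷ es) =
  ≡.trans (cong₂ (λ a b → a xor (b xor parity (preimage es))) (head-integrate false e) (head-integrate true e))
          (cong not (parity-preimage es))

preimage-balanced : (es : List (Edge n)) → redCount (preimage es) ≡ blueCount (preimage es)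
preimage-balanced [] = refl
preimage-balanced (e ∷ es) = begin
  countOf false (x ∷ y ∷ preimage es)  ≡⟨ count-opposite false x y _ last-y ⟩
  suc (redCount (preimage es))         ≡⟨ cong suc (preimage-balanced es) ⟩
  suc (blueCount (preimage es))        ≡⟨ sym (count-opposite true x y _ last-y) ⟩
  countOf true (x ∷ y ∷ preimage es)   ∎
  where
  open ≡-Reasoning
  x = integrate false e
  y = integrate true e
  last-y : last y ≡ not (last x)
  last-y = ≡.trans (cong last (integrate-not false e)) (last-complement x)

∈-preimage⁺ : ∀ b {e} {es : List (Edge n)} → e ∈ es → integrate b e ∈ preimage es
∈-preimage⁺ false (here refl) = here refl
∈-preimage⁺ true (here refl) = there (here refl)
∈-preimage⁺ b (there p) = there (there (∈-preimage⁺ b p))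

∈-preimage⁻ : {x : Edge (suc n)} {es : List (Edge n)} → x ∈ preimage es → diff x ∈ es
∈-preimage⁻ {es = e ∷ es} (here refl) = here (diff-integrate false e)
∈-preimage⁻ {es = e ∷ es} (there (here refl)) = here (diff-integrate true e)
∈-preimage⁻ {es = e ∷ es} (there (there p)) = there (∈-preimage⁻ p)

preimage-unique : {es : List (Edge n)} → Unique es → Unique (preimage es)
preimage-unique {es = []} [] = []
preimage-unique {es = e ∷ es} (e∉ ∷ u) = (heads-differ ∷ fresh false) ∷ fresh true ∷ preimage-unique u
  where
  heads-differ : integrate false e ≢ integrate true e
  heads-differ eq with ≡.trans (sym (head-integrate false e)) (≡.trans (cong head eq) (head-integrate true e))
  ... | ()
  fresh : ∀ b → All (integrate b e ≢_) (preimage es)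
  fresh b = ¬Any⇒All¬ _ (λ mem → All¬⇒¬Any e∉ (subst (_∈ es) (diff-integrate b e) (∈-preimage⁻ mem)))

Walk : Vertex n → Vertex n → List (Edge n) → Set
Walk u v [] = u ≡ v
Walk u v (e ∷ es) = source e ≡ u × Walk (target e) v es

walk-++ : {u v w : Vertex n} (xs : List (Edge n)) {ys : List (Edge n)} →
  Walk u v xs → Walk v w ys → Walk u w (xs ++ ys)
walk-++ [] refl q = q
walk-++ (x ∷ xs) (s , p) q = s , walk-++ xs p q

walk-++⁻ : {u w : Vertex n} (xs : List (Edge n)) {ys : List (Edge n)} →
  Walk u w (xs ++ ys) → ∃ λ v → Walk u v xs × Walk v w ys
walk-++⁻ [] p = _ , refl , p
walk-++⁻ (x ∷ xs) (s , p) with walk-++⁻ xs p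
... | v , q , r = v , (s , q) , r

walk-end-unique : {u v w : Vertex n} (xs : List (Edge n)) → Walk u v xs → Walk u w xs → v ≡ w
walk-end-unique [] refl refl = refl
walk-end-unique (x ∷ xs) (_ , p) (_ , q) = walk-end-unique xs p q

Cycle : List (Edge n) → Set
Cycle [] = ⊥
Cycle (e ∷ es) = Walk (source e) (source e) (e ∷ es)

cycle-returns : {u v : Vertex n} (B : List (Edge n)) → Cycle B → Walk u v B → u ≡ v
cycle-returns (e ∷ es) (_ , c) (s , w) = ≡.trans (sym s) (walk-end-unique es c w)

IsLoop : Edge n → Set
IsLoop e = target e ≡ source e

loop-cycle : {x : Edge n} → IsLoop x → Cycle (x ∷ [])
loop-cycle l = refl , l

record Circuit (c : List (Edge n)) : Set where
  constructor mkCircuit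
  field
    {start} : Vertex n
    closed : Walk start start c
    distinct : Unique c

rotate : (xs : List (Edge n)) {ys : List (Edge n)} → Circuit (xs ++ ys) → Circuit (ys ++ xs)
rotate xs {ys} (mkCircuit w u) with walk-++⁻ xs w
... | v , p , q = mkCircuit (walk-++ ys q p) (unique-↭ (++-comm xs ys) u)

excise : (xs B : List (Edge n)) {ys : List (Edge n)} → Cycle B → Circuit (xs ++ B ++ ys) → Circuit (xs ++ ys)
excise xs B {ys} cyc (mkCircuit w u) with walk-++⁻ xs w
... | v , p , q with walk-++⁻ B q
... | v′ , r , s = mkCircuit (walk-++ xs p (subst (λ t → Walk t _ ys) (sym (cycle-returns B cyc r)) s))
                           (unique-++ʳ B (unique-↭ (shifts xs B) u))

toIsCircuit : {c : List (Edge n)} → Circuit c → 1 ≤ length c → IsCircuit c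
toIsCircuit {c = e ∷ es} (mkCircuit (s , w) u) _ = subst (ChainTo (e ∷ es)) (sym s) (chain e es w) , u
  where
  chain : ∀ e es {v} → Walk (target e) v es → ChainTo (e ∷ es) v
  chain e [] w = w
  chain e (f ∷ es) (s , w) = sym s , chain f es w

-- Lifting along the D-morphism

-- The lift of a walk that starts at the preimage of its first vertex with first bit b.
liftFrom : Bool → List (Edge n) → List (Edge (suc n))
liftFrom b [] = []
liftFrom b (e ∷ es) = integrate b e ∷ liftFrom (b xor head e) es

liftFrom-++ : ∀ b (xs ys : List (Edge n)) → liftFrom b (xs ++ ys) ≡ liftFrom b xs ++ liftFrom (b xor parity xs) ys
liftFrom-++ b [] ys = cong (λ c → liftFrom c ys) (sym (xor-identityʳ b))
liftFrom-++ b (x ∷ xs) ys = cong (integrate b x ∷_) (≡.trans (liftFrom-++ (b xor head x) xs ys)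
  (cong (λ c → liftFrom (b xor head x) xs ++ liftFrom c ys) (xor-assoc b (head x) (parity xs))))

walk-liftFrom : ∀ b {u v : Vertex n} xs → Walk u v xs →
  Walk (integrate b u) (integrate (b xor parity xs) v) (liftFrom b xs)
walk-liftFrom b [] refl = cong (λ c → integrate c _) (sym (xor-identityʳ b))
walk-liftFrom b (e ∷ es) (s , w) =
  ≡.trans (init-integrate b e) (cong (integrate b) s) ,
  subst₂ (λ t c → Walk t (integrate c _) (liftFrom (b xor head e) es))
    (sym (tail-integrate b e)) (xor-assoc b (head e) (parity es)) (walk-liftFrom (b xor head e) es w)

∈-liftFrom⁻ : ∀ b {x} (es : List (Edge n)) → x ∈ liftFrom b es → diff x ∈ es
∈-liftFrom⁻ b (e ∷ es) (here refl) = here (diff-integrate b e)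
∈-liftFrom⁻ b (e ∷ es) (there p) = there (∈-liftFrom⁻ (b xor head e) es p)

parity-liftFrom-not : ∀ b (es : List (Edge n)) →
  parity (liftFrom (not b) es) ≡ parity (liftFrom b es) xor odd (length es)
parity-liftFrom-not b [] = sym (xor-identityʳ _)
parity-liftFrom-not b (e ∷ es) = begin
  head (integrate (not b) e) xor parity (liftFrom (not b xor head e) es)
    ≡⟨ cong₂ (λ h c → h xor parity (liftFrom c es)) (head-integrate (not b) e) (sym (not-distribˡ-xor b (head e))) ⟩
  not b xor parity (liftFrom (not (b xor head e)) es)
    ≡⟨ cong (not b xor_) (parity-liftFrom-not (b xor head e) es) ⟩
  not b xor (parity (liftFrom (b xor head e) es) xor odd (length es))
    ≡⟨ rearrange b _ _ ⟩
  (b xor parity (liftFrom (b xor head e) es)) xor not (odd (length es))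
    ≡⟨ cong (λ h → (h xor parity (liftFrom (b xor head e) es)) xor not (odd (length es))) (sym (head-integrate b e)) ⟩
  (head (integrate b e) xor parity (liftFrom (b xor head e) es)) xor not (odd (length es)) ∎
  where
  open ≡-Reasoning
  rearrange : ∀ a p o → not a xor (p xor o) ≡ (a xor p) xor not o
  rearrange true true o = refl
  rearrange true false o = sym (not-involutive o)
  rearrange false p o = not-distribʳ-xor p o

liftFrom-both-↭ : ∀ b (es : List (Edge n)) → liftFrom b es ++ liftFrom (not b) es ↭ preimage es
liftFrom-both-↭ b [] = refl
liftFrom-both-↭ b (e ∷ es) = begin
  integrate b e ∷ (liftFrom b′ es ++ integrate (not b) e ∷ liftFrom (not b xor head e) es)
    ↭⟨ prep _ (shift _ (liftFrom b′ es) _) ⟩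
  integrate b e ∷ integrate (not b) e ∷ (liftFrom b′ es ++ liftFrom (not b xor head e) es)
    ≡⟨ cong (λ c → integrate b e ∷ integrate (not b) e ∷ (liftFrom b′ es ++ liftFrom c es))
            (sym (not-distribˡ-xor b (head e))) ⟩
  integrate b e ∷ integrate (not b) e ∷ (liftFrom b′ es ++ liftFrom (not b′) es)
    ↭⟨ prep _ (prep _ (liftFrom-both-↭ b′ es)) ⟩
  integrate b e ∷ integrate (not b) e ∷ preimage es
    ↭⟨ in-order b ⟩
  preimage (e ∷ es) ∎
  where
  open PermutationReasoning
  b′ = b xor head e
  in-order : ∀ b → integrate b e ∷ integrate (not b) e ∷ preimage es ↭ preimage (e ∷ es)
  in-order false = refl
  in-order true = swap _ _ refl

length-liftFrom : ∀ b (es : List (Edge n)) → length (liftFrom b es) ≡ length es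
length-liftFrom b [] = refl
length-liftFrom b (e ∷ es) = cong suc (length-liftFrom (b xor head e) es)

-- An odd closed walk lifts to an open walk from one lift of its base vertex to the other;
-- the two lifts together close up.
walk-liftBoth : ∀ b {u : Vertex n} es → Walk u u es → parity es ≡ true →
  Walk (integrate b u) (integrate b u) (liftFrom b es ++ liftFrom (not b) es)
walk-liftBoth b {u} es w odd-es =
  walk-++ (liftFrom b es) (oneCopy b)
    (subst (λ c → Walk (integrate (not b) u) (integrate c u) (liftFrom (not b) es)) (not-involutive b) (oneCopy (not b)))
  where
  oneCopy : ∀ c → Walk (integrate c u) (integrate (not c) u) (liftFrom c es)
  oneCopy c = subst (λ d → Walk (integrate c u) (integrate d u) (liftFrom c es))
                (≡.trans (cong (c xor_) odd-es) (xor-comm c true)) (walk-liftFrom c es w)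

liftBoth-circuit : ∀ b {es : List (Edge n)} → Circuit es → parity es ≡ true → Circuit (liftFrom b es ++ liftFrom (not b) es)
liftBoth-circuit b {es} (mkCircuit w u) odd-es =
  mkCircuit (walk-liftBoth b es w odd-es) (unique-↭ (↭-sym (liftFrom-both-↭ b es)) (preimage-unique u))

zeros ones : (n : ℕ) → Edge n
zeros n = replicate (suc n) false
ones n = replicate (suc n) true

-- ones n is a loop, and its two lifts form a cycle of length two through the two lifts of its vertex.
liftThroughOnes : {rest : List (Edge n)} → Circuit (ones n ∷ rest) → parity rest ≡ true →
  Circuit (integrate false (ones n) ∷ integrate true (ones n) ∷ liftFrom false rest ++ liftFrom true rest)
liftThroughOnes {n} {rest} (mkCircuit (s , w) u) odd-rest =
  mkCircuit (source-lift false , source-lift true , walk-liftBoth false rest w′ odd-rest)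
          (unique-↭ (↭-sym (prep _ (prep _ (liftFrom-both-↭ false rest)))) (preimage-unique u))
  where
  w′ : Walk (replicate n true) (replicate n true) rest
  w′ = subst (λ v → Walk _ v rest) (≡.trans (sym s) (init-replicate n true)) w
  source-lift : ∀ b → source (integrate b (ones n)) ≡ integrate b (replicate n true)
  source-lift b = ≡.trans (init-integrate b (ones n)) (cong (integrate b) (init-replicate n true))

record LiftAround (B r : List (Edge n)) : Set where
  field
    s : Bool
    R R′ : List (Edge (suc n))
    circuit : Circuit (liftFrom s B ++ R ++ liftFrom (not s) B ++ R′)
    covers : liftFrom s B ++ R ++ liftFrom (not s) B ++ R′ ↭ preimage (B ++ r)

liftAroundOdd : (B r : List (Edge n)) → Circuit (B ++ r) → parity (B ++ r) ≡ true → LiftAround B r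
liftAroundOdd B r C odd-c = record
  { s = false ; R = liftFrom (parity B) r ; R′ = liftFrom (not (parity B)) r
  ; circuit = subst Circuit split (liftBoth-circuit false C odd-c)
  ; covers = subst (_↭ preimage (B ++ r)) split (liftFrom-both-↭ false (B ++ r)) }
  where
  split : liftFrom false (B ++ r) ++ liftFrom true (B ++ r)
        ≡ liftFrom false B ++ liftFrom (parity B) r ++ liftFrom true B ++ liftFrom (not (parity B)) r
  split = ≡.trans (cong₂ _++_ (liftFrom-++ false B r) (liftFrom-++ true B r)) (++-assoc (liftFrom false B) _ _)

-- Removing the loop ones makes the parity odd; the lift of the rest passes through both lifts of the
-- vertex of ones, where the two lifts of ones are reinserted as a 2-cycle. A rotation then puts K first.
liftAroundOnes : (B r : List (Edge n)) → Circuit (B ++ r) → parity (B ++ r) ≡ false → ones n ∈ r → LiftAround B r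
liftAroundOnes {n} B r C even-c o∈r with ∈-∃++ o∈r
... | xs , ys , refl = record
  { s = β ; R = H₁ ++ G₂ ; R′ = H₂ ++ A ++ G₁
  ; circuit = subst Circuit (rotated A G₁ K H₁ G₂ K′ H₂) (rotate (A ++ G₁) (subst Circuit lifted C₂))
  ; covers = begin
      K ++ (H₁ ++ G₂) ++ K′ ++ (H₂ ++ A ++ G₁)         ≡⟨ rotated A G₁ K H₁ G₂ K′ H₂ ⟨
      (K ++ H₁ ++ G₂ ++ K′ ++ H₂) ++ (A ++ G₁)         ↭⟨ ++-comm _ (A ++ G₁) ⟩
      (A ++ G₁) ++ (K ++ H₁ ++ G₂ ++ K′ ++ H₂)         ≡⟨ lifted ⟨
      A ++ liftFrom false rest ++ liftFrom true rest  ↭⟨ ++⁺ˡ A (liftFrom-both-↭ false rest) ⟩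
      preimage (O ∷ rest)                             ↭⟨ preimage-↭ round ⟩
      preimage (B ++ xs ++ O ∷ ys)                    ∎ }
  where
  open MonoidSolver (++-monoid (Edge (suc n)))
  open PermutationReasoning
  reassociate : ∀ a g k h g′ k′ h′ →
    a ++ (g ++ k ++ h) ++ (g′ ++ k′ ++ h′) ≡ (a ++ g) ++ (k ++ h ++ g′ ++ k′ ++ h′)
  reassociate = solve 7 (λ a g k h g′ k′ h′ →
    a ⊕ (g ⊕ k ⊕ h) ⊕ (g′ ⊕ k′ ⊕ h′) ⊜ (a ⊕ g) ⊕ (k ⊕ h ⊕ g′ ⊕ k′ ⊕ h′)) refl
  rotated : ∀ a g k h g′ k′ h′ →
    (k ++ h ++ g′ ++ k′ ++ h′) ++ (a ++ g) ≡ k ++ (h ++ g′) ++ k′ ++ (h′ ++ a ++ g)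
  rotated = solve 7 (λ a g k h g′ k′ h′ →
    (k ⊕ h ⊕ g′ ⊕ k′ ⊕ h′) ⊕ (a ⊕ g) ⊜ k ⊕ (h ⊕ g′) ⊕ k′ ⊕ (h′ ⊕ a ⊕ g)) refl
  O = ones n
  rest = ys ++ B ++ xs
  round : O ∷ rest ↭ B ++ xs ++ O ∷ ys
  round = ↭-trans (++-comm (O ∷ ys) (B ++ xs)) (↭-reflexive (++-assoc B xs (O ∷ ys)))
  odd-rest : parity rest ≡ true
  odd-rest = ≡.trans (sym (not-involutive _)) (cong not (≡.trans (parity-↭ round) even-c))
  C₂ = liftThroughOnes (rotate (B ++ xs) (subst Circuit (sym (++-assoc B xs (O ∷ ys))) C)) odd-rest
  β = parity ys
  A = integrate false O ∷ integrate true O ∷ []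
  G₁ = liftFrom false ys
  G₂ = liftFrom true ys
  K = liftFrom β B
  K′ = liftFrom (not β) B
  H₁ = liftFrom (β xor parity B) xs
  H₂ = liftFrom (not β xor parity B) xs
  lifted : A ++ liftFrom false rest ++ liftFrom true rest ≡ (A ++ G₁) ++ (K ++ H₁ ++ G₂ ++ K′ ++ H₂)
  lifted = ≡.trans (cong₂ (λ P Q → A ++ P ++ Q)
                      (≡.trans (liftFrom-++ false ys (B ++ xs)) (cong (G₁ ++_) (liftFrom-++ β B xs)))
                      (≡.trans (liftFrom-++ true ys (B ++ xs)) (cong (G₂ ++_) (liftFrom-++ (not β) B xs))))
                   (reassociate A G₁ K H₁ G₂ K′ H₂)

liftAround : (B r : List (Edge n)) → Circuit (B ++ r) → parity (B ++ r) ≡ true ⊎ ones n ∈ r → LiftAround B r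
liftAround B r C (inj₁ odd-c) = liftAroundOdd B r C odd-c
liftAround B r C (inj₂ o∈r) = by-parity (parity (B ++ r)) refl
  where
  by-parity : ∀ p → parity (B ++ r) ≡ p → LiftAround B r
  by-parity true odd-c = liftAroundOdd B r C odd-c
  by-parity false even-c = liftAroundOnes B r C even-c o∈r

-- Rich circuits and the induction

record Block (B : List (Edge n)) (p : Bool) : Set where
  field
    cycle : Cycle B
    length≡3 : length B ≡ 3
    parity≡ : parity B ≡ p

cycle-liftFrom : ∀ s (B : List (Edge n)) → Cycle B → parity B ≡ false → Cycle (liftFrom s B)
cycle-liftFrom s (e ∷ es) cyc even-B =
  subst (λ u → Walk u u (liftFrom s (e ∷ es))) (sym (init-integrate s e))
    (subst (λ c → Walk (integrate s (source e)) (integrate c (source e)) (liftFrom s (e ∷ es)))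
      (≡.trans (cong (s xor_) even-B) (xor-identityʳ s))
      (walk-liftFrom s (e ∷ es) cyc))

-- Since a block has odd length, its two lifts have opposite parities.
liftFrom-block : ∀ s {B : List (Edge n)} → Block B false →
  Block (liftFrom s B) (parity (liftFrom s B)) × Block (liftFrom (not s) B) (not (parity (liftFrom s B)))
liftFrom-block s {B} blk =
  record { cycle = cycle-liftFrom s B cycle parity≡ ; length≡3 = ≡.trans (length-liftFrom s B) length≡3 ; parity≡ = refl } ,
  record { cycle = cycle-liftFrom (not s) B cycle parity≡ ; length≡3 = ≡.trans (length-liftFrom (not s) B) length≡3
         ; parity≡ = ≡.trans (parity-liftFrom-not s B)
                       (≡.trans (cong (λ k → parity (liftFrom s B) xor odd k) length≡3) (xor-comm _ true)) }
  where open Block blk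

record Rich (n k : ℕ) : Set where
  field
    B r : List (Edge n)
    circuit : Circuit (B ++ r)
    block : Block B false
    zeros∈ : zeros n ∈ r
    good : parity (B ++ r) ≡ true ⊎ ones n ∈ r
    length≡ : length (B ++ r) ≡ k

record LiftedRich (n j : ℕ) : Set where
  field
    Be Rp Bo Rq : List (Edge n)
    circuit : Circuit (Be ++ Rp ++ Bo ++ Rq)
    evenBlock : Block Be false
    oddBlock : Block Bo true
    zeros∈ : zeros n ∈ Rp ++ Rq
    ones∈ : ones n ∈ Rp ++ Rq
    length≡ : length (Be ++ Rp ++ Bo ++ Rq) ≡ j + j
    parity≡ : parity (Be ++ Rp ++ Bo ++ Rq) ≡ odd j

orient : ∀ {j p} {K R K′ R′ : List (Edge n)} → Circuit (K ++ R ++ K′ ++ R′) → Block K p → Block K′ (not p) →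
  zeros n ∈ R ++ R′ → ones n ∈ R ++ R′ →
  length (K ++ R ++ K′ ++ R′) ≡ j + j → parity (K ++ R ++ K′ ++ R′) ≡ odd j → LiftedRich n j
orient {p = false} {K} {R} {K′} {R′} C bK bK′ z∈ o∈ len par = record
  { Be = K ; Rp = R ; Bo = K′ ; Rq = R′ ; circuit = C ; evenBlock = bK ; oddBlock = bK′
  ; zeros∈ = z∈ ; ones∈ = o∈ ; length≡ = len ; parity≡ = par }
orient {n} {p = true} {K} {R} {K′} {R′} C bK bK′ z∈ o∈ len par = record
  { Be = K′ ; Rp = R′ ; Bo = K ; Rq = R
  ; circuit = subst Circuit (++-assoc K′ R′ (K ++ R)) (rotate (K ++ R) (subst Circuit (sym (++-assoc K R (K′ ++ R′))) C))
  ; evenBlock = bK′ ; oddBlock = bK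
  ; zeros∈ = ∈-resp-↭ (++-comm R R′) z∈ ; ones∈ = ∈-resp-↭ (++-comm R R′) o∈
  ; length≡ = ≡.trans (↭-length swapped) len ; parity≡ = ≡.trans (parity-↭ swapped) par }
  where
  swapped : K′ ++ R′ ++ K ++ R ↭ K ++ R ++ K′ ++ R′
  swapped = solve 4 (λ k r k′ r′ → k′ ⊕ r′ ⊕ k ⊕ r ⊜ k ⊕ r ⊕ k′ ⊕ r′) ↭-refl K R K′ R′
    where open CommutativeMonoidSolver (++-commutativeMonoid {A = Edge n})

-- The two lifts of zeros n are zeros (suc n) and ones (suc n); they avoid the lifts of B because zeros n ∉ B.
liftRich : ∀ {j} → Rich n j → LiftedRich (suc n) j
liftRich {n} {j} rich = orient {R = R} {R′ = R′} liftedCircuit blockK blockK′ (lift∈ false) (lift∈ true) len par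
  where
  open Rich rich
  open LiftAround (liftAround B r circuit good) renaming (circuit to liftedCircuit)
  blockK = proj₁ (liftFrom-block s block)
  blockK′ = proj₂ (liftFrom-block s block)
  T = liftFrom s B ++ R ++ liftFrom (not s) B ++ R′
  len : length T ≡ j + j
  len = ≡.trans (↭-length covers) (≡.trans (length-preimage (B ++ r)) (cong (λ k → k + k) length≡))
  par : parity T ≡ odd j
  par = ≡.trans (parity-↭ covers) (≡.trans (parity-preimage (B ++ r)) (cong odd length≡))
  zeros∉B : zeros n ∉ B
  zeros∉B = unique-++-disjoint B (Circuit.distinct circuit) zeros∈
  avoids : ∀ b t → integrate b (zeros n) ∉ liftFrom t B
  avoids b t m = zeros∉B (subst (_∈ B) (diff-integrate b (zeros n)) (∈-liftFrom⁻ t B m))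
  lift∈ : ∀ b → replicate (suc (suc n)) b ∈ R ++ R′
  lift∈ b = subst (_∈ R ++ R′) (integrate-replicate (suc n) b)
    (∈-between (liftFrom s B) R (liftFrom (not s) B) R′
      (∈-resp-↭ (↭-sym covers) (∈-preimage⁺ b (∈-++⁺ʳ B zeros∈))) (avoids b s) (avoids b (not s)))

record OddCircuit (n k : ℕ) : Set where
  field
    edges : List (Edge n)
    circuit : Circuit edges
    length≡ : length edges ≡ k
    parity≡ : parity edges ≡ true

replicate-isLoop : ∀ n b → IsLoop (replicate (suc n) b)
replicate-isLoop n b = sym (init-replicate n b)

zeros≢ones : zeros n ≢ ones n
zeros≢ones eq with cong head eq
... | ()

record WithoutLoop (B r : List (Edge n)) (x : Edge n) : Set where
  field
    r′ : List (Edge n)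
    circuit : Circuit (B ++ r′)
    length≡ : length (B ++ r) ≡ suc (length (B ++ r′))
    parity≡ : parity (B ++ r′) ≡ head x xor parity (B ++ r)
    kept : ∀ {y} → y ∈ r → y ≢ x → y ∈ r′

removeLoop : (B : List (Edge n)) {r : List (Edge n)} {x : Edge n} → Circuit (B ++ r) → x ∈ r → IsLoop x →
  WithoutLoop B r x
removeLoop B {x = x} C x∈r loop with ∈-∃++ x∈r
... | xs , ys , refl = record
  { r′ = xs ++ ys
  ; circuit = subst Circuit (++-assoc B xs ys)
      (excise (B ++ xs) (x ∷ []) (loop-cycle loop) (subst Circuit (sym (++-assoc B xs (x ∷ ys))) C))
  ; length≡ = ↭-length whole
  ; parity≡ = sym (≡.trans (cong (head x xor_) (parity-↭ whole)) (xor-cancelˡ (head x) _))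
  ; kept = ∈-after-removal (shift x xs ys) }
  where
  whole : B ++ xs ++ x ∷ ys ↭ x ∷ B ++ xs ++ ys
  whole = ↭-trans (++⁺ˡ B (shift x xs ys)) (shift x B (xs ++ ys))

removeBlock : (Be Rp Bo Rq : List (Edge n)) → Cycle Bo → Circuit (Be ++ Rp ++ Bo ++ Rq) →
  Circuit (Be ++ Rp ++ Rq) × Be ++ Rp ++ Bo ++ Rq ↭ Bo ++ Be ++ Rp ++ Rq
removeBlock {n} Be Rp Bo Rq cyc C =
  subst Circuit (++-assoc Be Rp Rq) (excise (Be ++ Rp) Bo cyc (subst Circuit (sym (++-assoc Be Rp (Bo ++ Rq))) C)) ,
  solve 4 (λ e p o q → e ⊕ p ⊕ o ⊕ q ⊜ o ⊕ e ⊕ p ⊕ q) ↭-refl Be Rp Bo Rq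
  where open CommutativeMonoidSolver (++-commutativeMonoid {A = Edge n})

withoutOddBlock : ∀ {i} (S : LiftedRich n (2 + i)) → let open LiftedRich S in
  Circuit (Be ++ Rp ++ Rq) × length (Be ++ Rp ++ Rq) ≡ 1 + (i + i) × parity (Be ++ Rp ++ Rq) ≡ not (odd (2 + i))
withoutOddBlock {n} {i} S = proj₁ removed , +-cancelˡ-≡ 3 _ _ len , par
  where
  open LiftedRich S
  open ≡-Reasoning
  removed = removeBlock Be Rp Bo Rq (Block.cycle oddBlock) circuit
  len : 3 + length (Be ++ Rp ++ Rq) ≡ 3 + (1 + (i + i))
  len = begin
    3 + length (Be ++ Rp ++ Rq)           ≡⟨ cong (_+ length (Be ++ Rp ++ Rq)) (Block.length≡3 oddBlock) ⟨
    length Bo + length (Be ++ Rp ++ Rq)   ≡⟨ length-++ Bo ⟨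
    length (Bo ++ Be ++ Rp ++ Rq)         ≡⟨ ↭-length (proj₂ removed) ⟨
    length (Be ++ Rp ++ Bo ++ Rq)         ≡⟨ length≡ ⟩
    suc (suc i) + suc (suc i)             ≡⟨ ≡.trans (suc-+-suc (suc i)) (cong (suc ∘ suc) (suc-+-suc i)) ⟩
    3 + (1 + (i + i))                     ∎
  par : parity (Be ++ Rp ++ Rq) ≡ not (odd (2 + i))
  par = begin
    parity (Be ++ Rp ++ Rq)                  ≡⟨ not-involutive _ ⟨
    not (true xor parity (Be ++ Rp ++ Rq))
      ≡⟨ cong (λ p → not (p xor parity (Be ++ Rp ++ Rq))) (Block.parity≡ oddBlock) ⟨
    not (parity Bo xor parity (Be ++ Rp ++ Rq)) ≡⟨ cong not (parity-++ Bo _) ⟨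
    not (parity (Bo ++ Be ++ Rp ++ Rq))      ≡⟨ cong not (parity-↭ (proj₂ removed)) ⟨
    not (parity (Be ++ Rp ++ Bo ++ Rq))      ≡⟨ cong not parity≡ ⟩
    not (odd (2 + i))                        ∎

richOfLifted : ∀ {j} → LiftedRich n j → Rich n (j + j)
richOfLifted S = record
  { B = Be ; r = Rp ++ Bo ++ Rq ; circuit = circuit ; block = evenBlock
  ; zeros∈ = ∈-++-middle Rp Bo Rq zeros∈ ; good = inj₂ (∈-++-middle Rp Bo Rq ones∈) ; length≡ = length≡ }
  where open LiftedRich S

richWithoutOddBlock : ∀ {i} → LiftedRich n (2 + i) → Rich n (1 + (i + i))
richWithoutOddBlock S = record
  { B = Be ; r = Rp ++ Rq ; circuit = proj₁ shortened ; block = evenBlock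
  ; zeros∈ = zeros∈ ; good = inj₂ ones∈ ; length≡ = proj₁ (proj₂ shortened) }
  where
  open LiftedRich S
  shortened = withoutOddBlock S

richWithoutOnes : ∀ {i} → LiftedRich n (1 + i) → odd (1 + i) ≡ false → Rich n (1 + (i + i))
richWithoutOnes {n} {i} S even-j = record
  { B = S.Be ; r = W.r′ ; circuit = W.circuit ; block = S.evenBlock
  ; zeros∈ = W.kept (∈-++-middle S.Rp S.Bo S.Rq S.zeros∈) zeros≢ones
  ; good = inj₁ (≡.trans W.parity≡ (cong not (≡.trans S.parity≡ even-j)))
  ; length≡ = suc-injective (≡.trans (sym W.length≡) (≡.trans S.length≡ (suc-+-suc i))) }
  where
  module S = LiftedRich S
  module W = WithoutLoop (removeLoop S.Be S.circuit (∈-++-middle S.Rp S.Bo S.Rq S.ones∈) (replicate-isLoop n true))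

oddOfLifted : ∀ {j} → LiftedRich n j → odd j ≡ true → OddCircuit n (j + j)
oddOfLifted S odd-j = record { circuit = circuit ; length≡ = length≡ ; parity≡ = ≡.trans parity≡ odd-j }
  where open LiftedRich S

-- Removing the loop whose first bit is not (odd j) leaves odd parity.
oddWithoutLoop : ∀ {i} → LiftedRich n (1 + i) → OddCircuit n (1 + (i + i))
oddWithoutLoop {n} {i} S = by-parity (odd (1 + i)) refl
  where
  module S = LiftedRich S
  fromRemoval : ∀ {x} → not (head x) ≡ odd (1 + i) → WithoutLoop S.Be (S.Rp ++ S.Bo ++ S.Rq) x → OddCircuit n (1 + (i + i))
  fromRemoval {x} hx W = record
    { circuit = W.circuit
    ; length≡ = suc-injective (≡.trans (sym W.length≡) (≡.trans S.length≡ (suc-+-suc i)))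
    ; parity≡ = ≡.trans W.parity≡ (≡.trans (cong (head x xor_) (≡.trans S.parity≡ (sym hx))) (xor-inverseʳ (head x))) }
    where module W = WithoutLoop W
  by-parity : ∀ p → odd (1 + i) ≡ p → OddCircuit n (1 + (i + i))
  by-parity true odd-j =
    fromRemoval (sym odd-j) (removeLoop S.Be S.circuit (∈-++-middle S.Rp S.Bo S.Rq S.zeros∈) (replicate-isLoop n false))
  by-parity false even-j =
    fromRemoval (sym even-j) (removeLoop S.Be S.circuit (∈-++-middle S.Rp S.Bo S.Rq S.ones∈) (replicate-isLoop n true))

oddWithoutOddBlockAndZeros : ∀ {i} → LiftedRich n (2 + i) → odd (2 + i) ≡ false → OddCircuit n (i + i)
oddWithoutOddBlockAndZeros {n} {i} S even-j = record
  { circuit = W.circuit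
  ; length≡ = suc-injective (≡.trans (sym W.length≡) (proj₁ (proj₂ shortened)))
  ; parity≡ = ≡.trans W.parity≡ (≡.trans (proj₂ (proj₂ shortened)) (cong not even-j)) }
  where
  module S = LiftedRich S
  shortened = withoutOddBlock S
  module W = WithoutLoop (removeLoop S.Be (proj₁ shortened) S.zeros∈ (replicate-isLoop n false))

-- Edges of G_{n+1} are the vertices of G_{n+2}; joins lists the edges between consecutive ones.
joins : Edge n → List (Edge n) → Edge n → List (Edge (suc n))
joins e [] f = (head e ∷ f) ∷ []
joins e (e′ ∷ es) f = (head e ∷ e′) ∷ joins e′ es f

walk-joins : ∀ (e : Edge n) es f {w} → Walk (target e) w es → source f ≡ w → Walk e f (joins e es f)
walk-joins (x ∷ e) [] f refl q = cong (x ∷_) q , refl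
walk-joins (x ∷ e) (e′ ∷ es) f (s , w) q = cong (x ∷_) s , walk-joins e′ es f w q

map-target-joins : ∀ (e : Edge n) es f → List.map target (joins e es f) ≡ es ++ f ∷ []
map-target-joins e [] f = refl
map-target-joins e (e′ ∷ es) f = cong (e′ ∷_) (map-target-joins e′ es f)

parity-joins : ∀ (e : Edge n) es f → parity (joins e es f) ≡ parity (e ∷ es)
parity-joins e [] f = refl
parity-joins e (e′ ∷ es) f = cong (head e xor_) (parity-joins e′ es f)

length-joins : ∀ (e : Edge n) es f → length (joins e es f) ≡ suc (length es)
length-joins e [] f = refl
length-joins e (e′ ∷ es) f = cong suc (length-joins e′ es f)

extend : ∀ {k} → OddCircuit n k → OddCircuit (suc n) k
extend record { edges = [] ; parity≡ = () }
extend record { edges = e ∷ es ; circuit = mkCircuit (s , w) u ; length≡ = len ; parity≡ = par } = record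
  { edges = joins e es e
  ; circuit = mkCircuit (walk-joins e es e w s)
      (map⁻ (subst Unique (sym (map-target-joins e es e)) (unique-↭ (++-comm (e ∷ []) es) u)))
  ; length≡ = ≡.trans (length-joins e es e) len
  ; parity≡ = ≡.trans (parity-joins e es e) par }

RichRange OddRange Invariant : ℕ → Set
RichRange n = ∀ k → 2 ^ n ≤ k → k ≤ 2 ^ suc n → Rich n k
OddRange n = ∀ k → 1 ≤ k → k < 2 ^ suc n → OddCircuit n k
Invariant n = OddRange n × RichRange n

even-2^suc : ∀ n → odd (2 ^ suc n) ≡ false
even-2^suc n = ≡.trans (cong odd (2^suc n)) (odd-+-self (2 ^ n))

evenBounds : ∀ n i → 2 ^ suc n ≤ i + i → i + i ≤ 2 ^ suc (suc n) → 2 ^ n ≤ i × i ≤ 2 ^ suc n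
evenBounds n i lo hi =
  double-≤-inv (2 ^ n) i (subst (_≤ i + i) (2^suc n) lo) , double-≤-inv i (2 ^ suc n) (subst (i + i ≤_) (2^suc (suc n)) hi)

oddBounds : ∀ n i → 2 ^ suc n ≤ suc (i + i) → suc (i + i) ≤ 2 ^ suc (suc n) → 2 ^ n ≤ suc i × suc i ≤ 2 ^ suc n
oddBounds n i lo hi =
  double-≤-inv (2 ^ n) (suc i)
    (≤-trans (subst (_≤ suc (i + i)) (2^suc n) lo) (subst (suc (i + i) ≤_) (sym (suc-+-suc i)) (n≤1+n _))) ,
  double-<-inv i (2 ^ suc n) (subst (i + i <_) (2^suc (suc n)) hi)

richStep : RichRange n → RichRange (suc n)
richStep {n} richs k lo hi with halve k
... | i , inj₁ refl = richOfLifted (liftRich (richs i (proj₁ bounds) (proj₂ bounds)))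
  where bounds = evenBounds n i lo hi
... | i , inj₂ refl with suc (suc i) ≤? 2 ^ suc n
...   | yes 2+i≤Q = richWithoutOddBlock (liftRich (richs (2 + i) (m≤n⇒m≤1+n (proj₁ bounds)) 2+i≤Q))
  where bounds = oddBounds n i lo hi
...   | no 2+i≰Q = richWithoutOnes (liftRich (richs (suc i) (proj₁ bounds) (proj₂ bounds)))
                     (≡.trans (cong odd (≤-antisym (proj₂ bounds) (≤-pred (≰⇒> 2+i≰Q)))) (even-2^suc n))
  where bounds = oddBounds n i lo hi

oddStep : RichRange n → OddRange n → OddRange (suc n)
oddStep {n} richs odds k pos hi with k <? 2 ^ suc n
... | yes k<Q = extend (odds k pos k<Q)
... | no k≮Q with halve k
...   | i , inj₂ refl = oddWithoutLoop (liftRich (richs (suc i) (proj₁ bounds) (proj₂ bounds)))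
  where bounds = oddBounds n i (≮⇒≥ k≮Q) (<⇒≤ hi)
...   | i , inj₁ refl = by-parity (odd i) refl
  where
  P≤i = proj₁ (evenBounds n i (≮⇒≥ k≮Q) (<⇒≤ hi))
  i<Q = double-<-inv i (2 ^ suc n) (subst (i + i <_) (2^suc (suc n)) hi)
  by-parity : ∀ p → odd i ≡ p → OddCircuit (suc n) (i + i)
  by-parity true odd-i = oddOfLifted (liftRich (richs i P≤i (<⇒≤ i<Q))) odd-i
  by-parity false even-i =
    oddWithoutOddBlockAndZeros (liftRich (richs (2 + i) (m≤n⇒m≤1+n (m≤n⇒m≤1+n P≤i)) (≤∧≢⇒< i<Q 1+i≢Q)))
      (≡.trans (not-involutive (odd i)) even-i)
    where
    1+i≢Q : suc i ≢ 2 ^ suc n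
    1+i≢Q eq = not-¬ (even-2^suc n) (≡.trans (cong odd (sym eq)) (cong not even-i))

step : Invariant n → Invariant (suc n)
step (odds , richs) = oddStep richs odds , richStep richs

GoodCircuit : (n k : ℕ) → Set
GoodCircuit n k = Σ (List (Edge n)) λ c → Circuit c × (parity c ≡ true ⊎ ones n ∈ c) × length c ≡ k

-- Small cases, checked by computation

bits : String → List Bool
bits s = List.map (λ c → String.fromChar c String.== "1") (String.toList s)

prefix : (m : ℕ) → List Bool → Vec Bool m
prefix zero bs = []
prefix (suc m) [] = false ∷ prefix m []
prefix (suc m) (b ∷ bs) = b ∷ prefix m bs

-- The edges read off the cyclic word s through a window of width n + 1, one at each position.
windows : (n : ℕ) → String → List (Edge n)
windows n s = slide (length w) (List.concat (List.replicate (suc (suc n)) w))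
  where
  w = bits s
  slide : ℕ → List Bool → List (Edge n)
  slide (suc i) (b ∷ bs) = prefix (suc n) (b ∷ bs) ∷ slide i bs
  slide _ _ = []

_≟ᵛ_ : (u v : Vec Bool n) → Dec (u ≡ v)
_≟ᵛ_ = ≡-dec Bool._≟_

walk? : (u v : Vertex n) (es : List (Edge n)) → Dec (Walk u v es)
walk? u v [] = u ≟ᵛ v
walk? u v (e ∷ es) = source e ≟ᵛ u ×-dec walk? (target e) v es

cycle? : (es : List (Edge n)) → Dec (Cycle es)
cycle? [] = no λ ()
cycle? (e ∷ es) = walk? (source e) (source e) (e ∷ es)

unique? : (es : List (Edge n)) → Dec (Unique es)
unique? = UniqueDec.unique? _≟ᵛ_

_∈?_ : (x : Edge n) (es : List (Edge n)) → Dec (x ∈ es)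
x ∈? es = MembershipDec._∈?_ _≟ᵛ_ x es

cycle-circuit : {es : List (Edge n)} → Cycle es → Unique es → Circuit es
cycle-circuit {es = e ∷ es} cyc u = mkCircuit cyc u

entry : List String → ℕ → String
entry [] i = ""
entry (w ∷ ws) zero = w
entry (w ∷ ws) (suc i) = entry ws i

-- Entry k - 1 is a word of length k and odd weight whose cyclic windows of width n + 1 are distinct,
-- for the least n with k < 2^{n+1}.
oddWords : List String
oddWords =
  ( "1"
  ∷ "01"
  ∷ "001"
  ∷ "0001"
  ∷ "00111"
  ∷ "000111"
  ∷ "0001011"
  ∷ "00001011"
  ∷ "000010011"
  ∷ "0000101111"
  ∷ "00001001111"
  ∷ "000010100111"
  ∷ "0000110101111"
  ∷ "00001001101111"
  ∷ "000010011010111"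
  ∷ "0000010001101111"
  ∷ "00010011101111100"
  ∷ "101011110011000100"
  ∷ "0100011111010011000"
  ∷ "10000111001011110110"
  ∷ "111100100110000011101"
  ∷ "1110010000011010011110"
  ∷ "11101101001111100100010"
  ∷ "000100101110101000011011"
  ∷ "0001101110100111100101100"
  ∷ "10100000100111001010110001"
  ∷ "010011011001010111110000111"
  ∷ "0110011111000110100000100101"
  ∷ "00001011001001101111101000111"
  ∷ "101001101100011101011110010000"
  ∷ "0010100111101011001000110111000"
  ∷ [] )

oddWord : ℕ → String
oddWord k = entry oddWords (k ∸ 1)

OddEdges : ℕ → List (Edge n) → Set
OddEdges k c = Cycle c × Unique c × length c ≡ k × parity c ≡ true

oddEdges? : ∀ k (c : List (Edge n)) → Dec (OddEdges k c)
oddEdges? k c = cycle? c ×-dec unique? c ×-dec length c ℕ.≟ k ×-dec parity c Bool.≟ true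

OddWord : ℕ → ℕ → Set
OddWord n k = OddEdges k (windows n (oddWord k))

oddWords-valid : ∀ {n} → n < 5 → ∀ {k} → k < 2 ^ suc n → 2 ^ n ≤ k → OddWord n k
oddWords-valid =
  from-yes (allUpTo? (λ n → allUpTo? (λ k → 2 ^ n ≤? k →-dec oddEdges? k (windows n (oddWord k))) (2 ^ suc n)) 5)

fromOddWord : ∀ {n k} → OddWord n k → OddCircuit n k
fromOddWord (cyc , u , len , par) = record { circuit = cycle-circuit cyc u ; length≡ = len ; parity≡ = par }

-- Each oddWord k is checked only at the least level n with k < 2^{n+1}; extend covers the others.
oddBase : ∀ n → n < 5 → ∀ k → 1 ≤ k → k < 2 ^ suc n → OddCircuit n k
oddBase n n<5 k pos k< with k <? 2 ^ n
oddBase zero n<5 k pos k< | yes k<1 = ⊥-elim (<⇒≱ k<1 pos)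
oddBase (suc n) n<5 k pos k< | yes k<2^n = extend (oddBase n (<-trans (n<1+n n) n<5) k pos k<2^n)
... | no k≮2^n = fromOddWord (oddWords-valid n<5 k< (≮⇒≥ k≮2^n))

-- Entry n is a De Bruijn word of order n + 1.
deBruijnWords : List String
deBruijnWords =
  ( "01"
  ∷ "0011"
  ∷ "00010111"
  ∷ "0000100110101111"
  ∷ [] )

FullEdges : List (Edge n) → Set
FullEdges {n} c = Cycle c × Unique c × ones n ∈ c × length c ≡ 2 ^ suc n

fullEdges? : (c : List (Edge n)) → Dec (FullEdges c)
fullEdges? {n} c = cycle? c ×-dec unique? c ×-dec ones n ∈? c ×-dec length c ℕ.≟ 2 ^ suc n

DeBruijnWord : ℕ → Set
DeBruijnWord n = FullEdges (windows n (entry deBruijnWords n))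

deBruijnWords-valid : ∀ {n} → n < 4 → DeBruijnWord n
deBruijnWords-valid = from-yes (allUpTo? (λ n → fullEdges? (windows n (entry deBruijnWords n))) 4)

fromDeBruijnWord : ∀ {n} → DeBruijnWord n → GoodCircuit n (2 ^ suc n)
fromDeBruijnWord (cyc , u , o∈ , len) = _ , cycle-circuit cyc u , inj₂ o∈ , len

-- Entry k - 16 is a word of length k whose windows of width 5 form a rich circuit,
-- the block being its first three windows.
richWords : List String
richWords =
  ( "1011011100000100"
  ∷ "10110111110100000"
  ∷ "110110100000101011"
  ∷ "1101101001100000111"
  ∷ "10110111110100100000"
  ∷ "011011000100000111110"
  ∷ "1011011111010100000100"
  ∷ "01101100011111010000010"
  ∷ "011011000111101010000010"
  ∷ "1101101010011000001000111"
  ∷ "11011010010111110000010001"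
  ∷ "101101110011111010100100000"
  ∷ "1011011111010100110000011100"
  ∷ "11011010111001100010100000111"
  ∷ "101101110001111101000001001100"
  ∷ "1011011100111101010010000011000"
  ∷ "10110111110101001110000011001000"
  ∷ [] )

RichEdges : ℕ → List (Edge n) → Set
RichEdges {n} k c = Cycle c × Unique c × Cycle B × length B ≡ 3 × parity B ≡ false × zeros n ∈ r ×
                    (parity c ≡ true ⊎ ones n ∈ r) × length c ≡ k
  where
  B = List.take 3 c
  r = List.drop 3 c

richEdges? : ∀ k (c : List (Edge n)) → Dec (RichEdges k c)
richEdges? {n} k c = cycle? c ×-dec unique? c ×-dec cycle? B ×-dec length B ℕ.≟ 3 ×-dec parity B Bool.≟ false ×-dec
                     zeros n ∈? r ×-dec (parity c Bool.≟ true ⊎-dec ones n ∈? r) ×-dec length c ℕ.≟ k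
  where
  B = List.take 3 c
  r = List.drop 3 c

richWord : ℕ → String
richWord k = entry richWords (k ∸ 16)

RichWord : ℕ → Set
RichWord k = RichEdges k (windows 4 (richWord k))

richWords-valid : ∀ {k} → k < 33 → 16 ≤ k → RichWord k
richWords-valid = from-yes (allUpTo? (λ k → 16 ≤? k →-dec richEdges? k (windows 4 (richWord k))) 33)

fromRichWord : ∀ {k} → RichWord k → Rich 4 k
fromRichWord {k} (cyc , u , cycB , lenB , parB , z∈ , good , len) = record
  { B = List.take 3 c ; r = List.drop 3 c
  ; circuit = subst Circuit (sym (take++drop≡id 3 c)) (cycle-circuit cyc u)
  ; block = record { cycle = cycB ; length≡3 = lenB ; parity≡ = parB }
  ; zeros∈ = z∈
  ; good = subst (λ d → parity d ≡ true ⊎ ones 4 ∈ List.drop 3 c) (sym (take++drop≡id 3 c)) good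
  ; length≡ = ≡.trans (cong length (take++drop≡id 3 c)) len }
  where c = windows 4 (richWord k)

richBase : ∀ k → 2 ^ 4 ≤ k → k ≤ 2 ^ 5 → Rich 4 k
richBase k lo hi = fromRichWord (richWords-valid (s≤s hi) lo)

oddGood : ∀ {k} → OddCircuit n k → GoodCircuit n k
oddGood o = edges , circuit , inj₁ parity≡ , length≡
  where open OddCircuit o

invariant : ∀ m → Invariant (4 + m)
invariant zero = oddBase 4 (n<1+n 4) , richBase
invariant (suc m) = step (invariant m)

goodOfInvariant : Invariant n → ∀ k → 1 ≤ k → k ≤ 2 ^ suc n → GoodCircuit n k
goodOfInvariant {n} (odds , richs) k pos hi with k <? 2 ^ suc n
... | yes k< = oddGood (odds k pos k<)
... | no k≮ = B ++ r , circuit , Sum.map₂ (∈-++⁺ʳ B) good , length≡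
  where open Rich (richs k (≤-trans (m≤m+n (2 ^ n) _) (≮⇒≥ k≮)) hi)

smallGood : ∀ {n} → n < 4 → ∀ k → 1 ≤ k → k ≤ 2 ^ suc n → GoodCircuit n k
smallGood {n} n<4 k pos hi with k <? 2 ^ suc n
... | yes k< = oddGood (oddBase n (<-trans n<4 (n<1+n 4)) k pos k<)
... | no k≮ = subst (GoodCircuit n) (≤-antisym (≮⇒≥ k≮) hi) (fromDeBruijnWord (deBruijnWords-valid n<4))

goodCircuit : ∀ n k → 1 ≤ k → k ≤ 2 ^ suc n → GoodCircuit n k
goodCircuit n with n <? 4
... | yes n<4 = smallGood n<4
... | no n≮4 = goodOfInvariant (subst Invariant (m+[n∸m]≡n (≮⇒≥ n≮4)) (invariant (n ∸ 4)))

balancedLift : {c : List (Edge n)} → Circuit c → parity c ≡ true ⊎ ones n ∈ c → 1 ≤ length c →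
  Σ (List (Edge (suc n))) λ c′ → IsCircuit c′ × IsBalanced c′ × length c′ ≡ 2 * length c
balancedLift {n} {c} C good pos =
  R ++ R′ , toIsCircuit circuit (≤-trans pos (subst (length c ≤_) (sym len) (m≤m+n _ _))) , balanced , len
  where
  open LiftAround (liftAround [] c C good)
  len : length (R ++ R′) ≡ 2 * length c
  len = ≡.trans (↭-length covers) (≡.trans (length-preimage c) (cong (length c +_) (sym (+-identityʳ _))))
  balanced : redCount (R ++ R′) ≡ blueCount (R ++ R′)
  balanced = ≡.trans (redCount-↭ covers) (≡.trans (preimage-balanced c) (sym (blueCount-↭ covers)))

lemma6 : (m k : ℕ) → 1 ≤ m → 1 ≤ k → 2 * k ≤ 2 ^ suc m →
    Σ (List (Edge m)) (λ c → IsCircuit c × IsBalanced c × length c ≡ 2 * k)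
lemma6 (suc n) k _ pos bound with goodCircuit n k pos (*-cancelˡ-≤ 2 bound)
... | c , C , good , refl = balancedLift C good pos
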